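{- For integers $1\le k\le d$, $$\sum_{\mathcal P}C_{a_1-1}C_{a_2-1}\cdots C_{a_k-1}=\binom{2d-k-1}{d-1},$$ where the sum is over all cyclic compositions $\mathcal P=\{\mathcal B_1,\ldots,\mathcal B_k\}$ of $d$ into $k$ parts, $a_i=|\mathcal B_i|$, and $C_m=\frac{1}{m+1}\binom{2m}{m}$ is the $m$th Catalan number.
   Context: Let $\mathbb Z_d$ denote the integers modulo $d$, viewed also as the cycle graph on $d$ labeled vertices in which $i$ and $i+1$ (mod $d$) are adjacent. A cyclic composition of $d$ into $k$ parts is a set partition $\mathcal P=\{\mathcal B_1,\ldots,\mathcal B_k\}$ of $\mathbb Z_d$ in which each block $\mathcal B_i$ is the image of an interval of integers $[p_i,q_i]$ with $0\le q_i-p_i\le d-1$ under the quotient map $\mathbb Z\to\mathbb Z_d$ (equivalently, a subgraph of the cycle obtained by deleting $k\ge1$ edges, whose $k$ components are paths). The size of a part is $|\mathcal B_i|=q_i-p_i+1$. -}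

module Defs where

open import Data.Bool using (Bool; true; false; T; if_then_else_)
open import Data.Bool.Properties using (T?)
open import Data.Nat using (ℕ; zero; suc; _+_; _*_; _∸_; _/_; _%_)
open import Data.Nat.Properties using (_≟_)
open import Data.Nat.DivMod using (m%n<n)
open import Data.Nat.Combinatorics using (_C_)
open import Data.Fin using (Fin; toℕ; fromℕ<)
open import Data.Fin.Subset using (Subset; inside; outside; ∣_∣)
open import Data.Vec using (Vec; []; _∷_; lookup)
open import Data.List using (List; []; _∷_; [_]; map; _++_; filter; applyUpTo; allFin)
open import Data.Nat.ListAction using (sum; product)

-- Catalan number C_m = (1/(m+1)) * binom(2m, m)   (exact division)
catalan : ℕ → ℕ
catalan m = ((2 * m) C m) / suc m

allSubsets : (n : ℕ) → List (Subset n)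
allSubsets zero = [ [] ]
allSubsets (suc n) = map (outside ∷_) (allSubsets n) ++ map (inside ∷_) (allSubsets n)

-- Cycle graph Z_d with d = suc n.  Edge e ∈ Fin d joins vertices e and e+1 (mod d).
-- e ⊕ t = e + t  (mod d)
_⊕_ : {n : ℕ} → Fin (suc n) → ℕ → Fin (suc n)
_⊕_ {n} e t = fromℕ< (m%n<n (toℕ e + t) (suc n))

-- A cyclic composition of d = suc n is given by a nonempty set S ⊆ Fin d of
-- deleted edges of the cycle.  For a deleted edge e ∈ S, the part starting right
-- after e is the path of vertices e+1, e+2, ..., e+t (mod d), where t ∈ [1, d] is
-- least with edge e+t deleted.  'partSize S e' is this t.
firstHit : {n : ℕ} → Subset (suc n) → Fin (suc n) → List ℕ → ℕ
firstHit {n} S e [] = suc n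
firstHit S e (t ∷ ts) = if lookup S (e ⊕ t) then t else firstHit S e ts

partSize : {n : ℕ} → Subset (suc n) → Fin (suc n) → ℕ
partSize {n} S e = firstHit S e (applyUpTo suc (suc n))

members : {n : ℕ} → Subset n → List (Fin n)
members {n} S = filter (λ e → T? (lookup S e)) (allFin n)

weight : {n : ℕ} → Subset (suc n) → ℕ
weight S = product (map (λ e → catalan (partSize S e ∸ 1)) (members S))

cycSum : ℕ → ℕ → ℕ
cycSum zero k = 0
cycSum (suc n) k = sum (map weight (filter (λ S → ∣ S ∣ ≟ k) (allSubsets (suc n))))

module Submission where

-- A cyclic composition of d into k parts is determined by the set S of its k
-- deleted edges of the cycle Z_d; the part following a deleted edge e consists of
-- the g kept edges after e (and has g+1 vertices), contributing C_g.  Reading the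
-- edges 0,…,d−1 as a word (true = deleted), the weight of S is computed by a linear
-- scan: parts are closed at each deleted edge, and the part after the last deleted
-- edge wraps around and absorbs the leading kept edges.
--
-- The theorem follows with d = z+j+1 and k = j+1, since 2d−k−1 = 2z+j.

open import Defs
open import Function using (_∘_)
open import Level using (0ℓ)
open import Data.Bool using (Bool; true; false; if_then_else_)
open import Data.Bool.Properties using (T?)
open import Data.List using (List; []; _∷_; _++_; map; filter; applyUpTo; tabulate)
open import Data.List.Properties using (filter-++; map-++; map-∘; map-cong; filter-none; filter-≐)
open import Data.List.Relation.Unary.All using (universal)
open import Data.Nat.ListAction using (sum; product)
open import Data.Nat.ListAction.Properties using (sum-++)
open import Data.Nat
open import Data.Nat.Properties
open import Data.Nat.Combinatorics using (_C_; nCk+nC[k+1]≡[n+1]C[k+1]; nCk≡nC[n∸k]; k>n⇒nCk≡0; nC1≡n)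
open import Data.Nat.DivMod using (m*n/n≡m; m%n<n; m<n⇒m%n≡m; [m+n]%n≡m%n)
open import Data.Nat.Tactic.RingSolver using (solve-∀)
open import Data.Fin using (Fin; toℕ; fromℕ<) renaming (zero to fzero; suc to fsuc)
open import Data.Fin.Properties using (fromℕ<-cong; fromℕ<-toℕ; toℕ<n)
open import Data.Fin.Subset using (Subset; ∣_∣; inside; outside)
open import Data.Vec using (Vec; []; _∷_; lookup; toList)
open import Data.Product using (_,_)
open import Data.Sum using (inj₁; inj₂)
open import Relation.Binary.PropositionalEquality
open import Relation.Nullary using (Dec; does; yes; no)
open import Relation.Unary using (Decidable; Pred)
open ≡-Reasoning

Σ≤ : ℕ → (ℕ → ℕ) → ℕ
Σ≤ zero    f = f 0
Σ≤ (suc n) f = f 0 + Σ≤ n (f ∘ suc)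

Σ-cong : ∀ n {f g : ℕ → ℕ} → (∀ t → t ≤ n → f t ≡ g t) → Σ≤ n f ≡ Σ≤ n g
Σ-cong zero    f≗g = f≗g 0 z≤n
Σ-cong (suc n) f≗g = cong₂ _+_ (f≗g 0 z≤n) (Σ-cong n (λ t t≤n → f≗g (suc t) (s≤s t≤n)))

Σ-distrib-+ : ∀ n (f g : ℕ → ℕ) → Σ≤ n (λ t → f t + g t) ≡ Σ≤ n f + Σ≤ n g
Σ-distrib-+ zero    f g = refl
Σ-distrib-+ (suc n) f g = trans (cong (f 0 + g 0 +_) (Σ-distrib-+ n (f ∘ suc) (g ∘ suc)))
  (interchange (f 0) (g 0) (Σ≤ n (f ∘ suc)) (Σ≤ n (g ∘ suc)))
  where
  interchange : ∀ a b c e → a + b + (c + e) ≡ a + c + (b + e)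
  interchange = solve-∀

Σ-scale : ∀ n c (f : ℕ → ℕ) → Σ≤ n (λ t → c * f t) ≡ c * Σ≤ n f
Σ-scale zero    c f = refl
Σ-scale (suc n) c f = trans (cong (c * f 0 +_) (Σ-scale n c (f ∘ suc))) (sym (*-distribˡ-+ c (f 0) _))

Σ-snoc : ∀ n (f : ℕ → ℕ) → Σ≤ (suc n) f ≡ Σ≤ n f + f (suc n)
Σ-snoc zero    f = refl
Σ-snoc (suc n) f = trans (cong (f 0 +_) (Σ-snoc n (f ∘ suc))) (sym (+-assoc (f 0) _ _))

Σ-const : ∀ n (f : ℕ → ℕ) c → (∀ t → t ≤ n → f t ≡ c) → Σ≤ n f ≡ suc n * c
Σ-const zero    f c f≡c = trans (f≡c 0 z≤n) (sym (+-identityʳ c))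
Σ-const (suc n) f c f≡c = cong₂ _+_ (f≡c 0 z≤n) (Σ-const n (f ∘ suc) c (λ t t≤n → f≡c (suc t) (s≤s t≤n)))

Σ-reverse : ∀ n (f : ℕ → ℕ) → Σ≤ n f ≡ Σ≤ n (λ t → f (n ∸ t))
Σ-reverse zero    f = refl
Σ-reverse (suc n) f = begin
  f 0 + Σ≤ n (f ∘ suc)                        ≡⟨ cong (f 0 +_) (Σ-reverse n (f ∘ suc)) ⟩
  f 0 + Σ≤ n (λ t → f (suc (n ∸ t)))          ≡⟨ +-comm (f 0) _ ⟩
  Σ≤ n (λ t → f (suc (n ∸ t))) + f 0          ≡⟨ cong₂ _+_ (Σ-cong n (λ t t≤n → cong f (sym (+-∸-assoc 1 t≤n))))
                                                          (cong f (sym (n∸n≡0 n))) ⟩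
  Σ≤ n (λ t → f (suc n ∸ t)) + f (suc n ∸ suc n) ≡⟨ sym (Σ-snoc n (λ t → f (suc n ∸ t))) ⟩
  Σ≤ (suc n) (λ t → f (suc n ∸ t))            ∎

Triangle : ℕ → (ℕ → ℕ → ℕ) → ℕ
Triangle n G = Σ≤ n (λ t → Σ≤ (n ∸ t) (G t))

Antidiagonal : ℕ → (ℕ → ℕ → ℕ) → ℕ
Antidiagonal m G = Σ≤ m (λ t → G t (m ∸ t))

Triangle-snoc : ∀ n G → Triangle (suc n) G ≡ Triangle n G + Antidiagonal (suc n) G
Triangle-snoc zero    G = +-assoc (G 0 0) (G 0 1) (G 1 0)
Triangle-snoc (suc n) G = begin
  Σ≤ (suc (suc n)) (G 0) + Triangle (suc n) (G ∘ suc)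
    ≡⟨ cong₂ _+_ (Σ-snoc (suc n) (G 0)) (Triangle-snoc n (G ∘ suc)) ⟩
  (Σ≤ (suc n) (G 0) + G 0 (suc (suc n))) + (Triangle n (G ∘ suc) + Antidiagonal (suc n) (G ∘ suc))
    ≡⟨ interchange (Σ≤ (suc n) (G 0)) (G 0 (suc (suc n))) (Triangle n (G ∘ suc)) (Antidiagonal (suc n) (G ∘ suc)) ⟩
  (Σ≤ (suc n) (G 0) + Triangle n (G ∘ suc)) + (G 0 (suc (suc n)) + Antidiagonal (suc n) (G ∘ suc)) ∎
  where
  interchange : ∀ a b c e → a + b + (c + e) ≡ a + c + (b + e)
  interchange = solve-∀

Antidiagonal-swap : ∀ m G → Antidiagonal m G ≡ Antidiagonal m (λ a b → G b a)
Antidiagonal-swap m G = trans (Σ-reverse m (λ t → G t (m ∸ t)))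
  (Σ-cong m (λ t t≤m → cong (G (m ∸ t)) (m∸[m∸n]≡n t≤m)))

Triangle-swap : ∀ n G → Triangle n G ≡ Triangle n (λ a b → G b a)
Triangle-swap zero    G = refl
Triangle-swap (suc n) G = begin
  Triangle (suc n) G                                   ≡⟨ Triangle-snoc n G ⟩
  Triangle n G + Antidiagonal (suc n) G                ≡⟨ cong₂ _+_ (Triangle-swap n G) (Antidiagonal-swap (suc n) G) ⟩
  Triangle n G′ + Antidiagonal (suc n) G′              ≡⟨ sym (Triangle-snoc n G′) ⟩
  Triangle (suc n) G′                                  ∎
  where
  G′ : ℕ → ℕ → ℕ
  G′ a b = G b a

absorption : ∀ n k → suc k * (suc n C suc k) ≡ suc n * (n C k)
absorption zero    zero    = refl
absorption zero    (suc k) = begin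
  suc (suc k) * (1 C suc (suc k)) ≡⟨ cong (suc (suc k) *_) (k>n⇒nCk≡0 {1} {suc (suc k)} (s≤s (s≤s z≤n))) ⟩
  suc (suc k) * 0                 ≡⟨ *-zeroʳ (suc (suc k)) ⟩
  0                               ≡⟨ cong (1 *_) (sym (k>n⇒nCk≡0 {0} {suc k} (s≤s z≤n))) ⟩
  1 * (0 C suc k)                 ∎
absorption (suc n) zero    = trans (+-identityʳ _) (trans (nC1≡n (suc (suc n))) (sym (*-identityʳ (suc (suc n)))))
absorption (suc n) (suc k) = begin
  suc (suc k) * (suc (suc n) C suc (suc k))     ≡⟨ cong (suc (suc k) *_) (sym (nCk+nC[k+1]≡[n+1]C[k+1] (suc n) (suc k))) ⟩
  suc (suc k) * (A + B)                         ≡⟨ expand k A B ⟩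
  A + suc k * A + suc (suc k) * B               ≡⟨ cong₂ (λ x y → A + x + y) (absorption n k) (absorption n (suc k)) ⟩
  A + suc n * (n C k) + suc n * (n C suc k)     ≡⟨ +-assoc A _ _ ⟩
  A + (suc n * (n C k) + suc n * (n C suc k))   ≡⟨ cong (A +_) (sym (*-distribˡ-+ (suc n) (n C k) (n C suc k))) ⟩
  A + suc n * (n C k + n C suc k)               ≡⟨ cong (λ x → A + suc n * x) (nCk+nC[k+1]≡[n+1]C[k+1] n k) ⟩
  A + suc n * A                                 ∎
  where
  A = suc n C suc k
  B = suc n C suc (suc k)
  expand : ∀ k a b → suc (suc k) * (a + b) ≡ a + suc k * a + suc (suc k) * b
  expand = solve-∀

-- The central binomial coefficient (2m choose m) and its neighbour (2m choose m+1);
-- the Catalan number is their difference.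
central central′ : ℕ → ℕ
central  m = (2 * m) C m
central′ m = (2 * m) C suc m

central′-absorption : ∀ m → suc m * central′ m ≡ m * central m
central′-absorption zero    = refl
central′-absorption (suc m) = begin
  suc (suc m) * (suc N C suc (suc m))  ≡⟨ absorption N (suc m) ⟩
  suc N * (N C suc m)                  ≡⟨ cong (suc N *_) symmetric ⟩
  suc N * (N C m)                      ≡⟨ sym (absorption N m) ⟩
  suc m * (suc N C suc m)              ∎
  where
  N = m + suc (m + 0)
  N≡ : ∀ m → m + suc (m + 0) ≡ suc m + m
  N≡ = solve-∀
  symmetric : N C suc m ≡ N C m
  symmetric = trans (nCk≡nC[n∸k] (subst (suc m ≤_) (sym (N≡ m)) (m≤m+n (suc m) m)))
    (cong (N C_) (trans (cong (_∸ suc m) (N≡ m)) (m+n∸m≡n (suc m) m)))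

-- Hence (2m choose m+1) ≤ (2m choose m): the truncated subtraction below is exact.
central′≤central : ∀ m → central′ m ≤ central m
central′≤central m = *-cancelˡ-≤ (suc m)
  (subst (_≤ suc m * central m) (sym (central′-absorption m)) (*-monoˡ-≤ (central m) (n≤1+n m)))

difference-scaled : ∀ m → suc m * (central m ∸ central′ m) ≡ central m
difference-scaled m = begin
  suc m * (central m ∸ central′ m)       ≡⟨ *-distribˡ-∸ (suc m) (central m) (central′ m) ⟩
  suc m * central m ∸ suc m * central′ m ≡⟨ cong (suc m * central m ∸_) (central′-absorption m) ⟩
  (central m + m * central m) ∸ m * central m ≡⟨ m+n∸n≡m (central m) (m * central m) ⟩
  central m                              ∎

-- C_m = (2m choose m) − (2m choose m+1), since the division defining C_m is exact.
catalan≡difference : ∀ m → catalan m ≡ central m ∸ central′ m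
catalan≡difference m = begin
  central m / suc m                              ≡⟨ cong (_/ suc m) (sym (difference-scaled m)) ⟩
  suc m * (central m ∸ central′ m) / suc m       ≡⟨ cong (_/ suc m) (*-comm (suc m) (central m ∸ central′ m)) ⟩
  (central m ∸ central′ m) * suc m / suc m       ≡⟨ m*n/n≡m (central m ∸ central′ m) (suc m) ⟩
  central m ∸ central′ m                         ∎

ballot : ℕ → ℕ → ℕ
ballot i h = (i + (i + h)) C i

catalan-scaled : ∀ m → suc m * catalan m ≡ ballot m 0
catalan-scaled m = trans (cong (suc m *_) (catalan≡difference m)) (difference-scaled m)

ballot-symmetric : ∀ i h → ballot i h ≡ (i + (i + h)) C (i + h)
ballot-symmetric i h = trans (nCk≡nC[n∸k] (m≤m+n i (i + h))) (cong ((i + (i + h)) C_) (m+n∸m≡n i (i + h)))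

ballot-pascal : ∀ i h → ballot (suc i) (suc h) ≡ ballot (suc i) h + ballot i (suc (suc h))
ballot-pascal i h = begin
  ballot (suc i) (suc h)              ≡⟨ cong (_C suc i) (top i h) ⟩
  suc N C suc i                       ≡⟨ sym (nCk+nC[k+1]≡[n+1]C[k+1] N i) ⟩
  N C i + N C suc i                   ≡⟨ +-comm (N C i) _ ⟩
  N C suc i + N C i                   ≡⟨ cong₂ _+_ (cong (_C suc i) (left i h)) (cong (_C i) (right i h)) ⟩
  ballot (suc i) h + ballot i (suc (suc h)) ∎
  where
  N = suc (suc (i + i + h))
  top : ∀ i h → suc i + (suc i + suc h) ≡ suc (suc (suc (i + i + h)))
  top = solve-∀
  left : ∀ i h → suc (suc (i + i + h)) ≡ suc i + (suc i + h)
  left = solve-∀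
  right : ∀ i h → suc (suc (i + i + h)) ≡ i + (i + suc (suc h))
  right = solve-∀

ballot-double : ∀ m → ballot (suc m) 0 ≡ ballot m 1 + ballot m 1
ballot-double m = begin
  ballot (suc m) 0       ≡⟨ cong (_C suc m) (top m) ⟩
  suc N C suc m          ≡⟨ sym (nCk+nC[k+1]≡[n+1]C[k+1] N m) ⟩
  N C m + N C suc m      ≡⟨ cong (N C m +_) symmetric ⟩
  N C m + N C m          ≡⟨ cong₂ _+_ (cong (_C m) (bottom m)) (cong (_C m) (bottom m)) ⟩
  ballot m 1 + ballot m 1 ∎
  where
  N = suc (m + m)
  top : ∀ m → suc m + (suc m + 0) ≡ suc (suc (m + m))
  top = solve-∀
  bottom : ∀ m → suc (m + m) ≡ m + (m + 1)
  bottom = solve-∀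
  symmetric : N C suc m ≡ N C m
  symmetric = trans (nCk≡nC[n∸k] (s≤s (m≤m+n m m))) (cong (N C_) (m+n∸n≡m m m))

ballot-catalan : ∀ i → ballot (suc i) 0 ≡ catalan (suc i) + ballot i 2
ballot-catalan i = begin
  ballot (suc i) 0                                    ≡⟨ sym (m∸n+n≡m (central′≤central (suc i))) ⟩
  (central (suc i) ∸ central′ (suc i)) + central′ (suc i) ≡⟨ cong₂ _+_ (sym (catalan≡difference (suc i))) neighbour ⟩
  catalan (suc i) + ballot i 2                        ∎
  where
  N≡ : ∀ i → suc (i + suc (i + 0)) ≡ suc i + suc i
  N≡ = solve-∀
  N≡′ : ∀ i → suc (i + suc (i + 0)) ≡ i + (i + 2)
  N≡′ = solve-∀
  N∸ : suc i + suc i ∸ suc (suc i) ≡ i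
  N∸ = trans (cong (_∸ suc (suc i)) (+-suc (suc i) i)) (m+n∸m≡n (suc i) i)
  neighbour : central′ (suc i) ≡ ballot i 2
  neighbour = trans (nCk≡nC[n∸k] (subst (suc (suc i) ≤_) (sym (N≡ i)) (s≤s (m≤n+m (suc i) i))))
    (cong₂ _C_ (N≡′ i) (trans (cong (_∸ suc (suc i)) (N≡ i)) N∸))

ballot-convolution : ∀ i h → ballot i (suc h) ≡ Σ≤ i (λ a → catalan a * ballot (i ∸ a) h)
ballot-convolution zero    h       = refl
ballot-convolution (suc i) (suc h) = begin
  ballot (suc i) (suc (suc h))
    ≡⟨ ballot-pascal i (suc h) ⟩
  ballot (suc i) (suc h) + ballot i (suc (suc (suc h)))
    ≡⟨ cong₂ _+_ (trans (ballot-convolution (suc i) h) (split-last h)) (ballot-convolution i (suc (suc h))) ⟩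
  (X + c) + Y
    ≡⟨ swap-last X c Y ⟩
  (X + Y) + c
    ≡⟨ cong (_+ c) (sym (Σ-distrib-+ i _ _)) ⟩
  Σ≤ i (λ a → catalan a * ballot (suc i ∸ a) h + catalan a * ballot (i ∸ a) (suc (suc h))) + c
    ≡⟨ cong (_+ c) (Σ-cong i (λ a a≤i → trans (sym (*-distribˡ-+ (catalan a) _ _))
                                              (cong (catalan a *_) (pascal-shifted a a≤i)))) ⟩
  Σ≤ i (λ a → catalan a * ballot (suc i ∸ a) (suc h)) + c
    ≡⟨ sym (split-last (suc h)) ⟩
  Σ≤ (suc i) (λ a → catalan a * ballot (suc i ∸ a) (suc h)) ∎
  where
  c = catalan (suc i)
  X = Σ≤ i (λ a → catalan a * ballot (suc i ∸ a) h)
  Y = Σ≤ i (λ a → catalan a * ballot (i ∸ a) (suc (suc h)))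
  swap-last : ∀ x c y → x + c + y ≡ x + y + c
  swap-last = solve-∀
  split-last : ∀ h → Σ≤ (suc i) (λ a → catalan a * ballot (suc i ∸ a) h)
                   ≡ Σ≤ i (λ a → catalan a * ballot (suc i ∸ a) h) + catalan (suc i)
  split-last h = trans (Σ-snoc i _) (cong (Σ≤ i (λ a → catalan a * ballot (suc i ∸ a) h) +_)
    (trans (cong (λ x → catalan (suc i) * ballot x h) (n∸n≡0 i)) (*-identityʳ _)))
  pascal-shifted : ∀ a → a ≤ i → ballot (suc i ∸ a) h + ballot (i ∸ a) (suc (suc h)) ≡ ballot (suc i ∸ a) (suc h)
  pascal-shifted a a≤i rewrite +-∸-assoc 1 a≤i = sym (ballot-pascal (i ∸ a) h)
ballot-convolution (suc i) zero    = begin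
  ballot (suc i) 1
    ≡⟨ ballot-pascal i 0 ⟩
  ballot (suc i) 0 + ballot i 2
    ≡⟨ cong (_+ ballot i 2) (ballot-catalan i) ⟩
  c + ballot i 2 + ballot i 2
    ≡⟨ cong₂ (λ x y → c + x + y) (ballot-convolution i 1) (ballot-convolution i 1) ⟩
  c + Z + Z
    ≡⟨ rearrange c Z ⟩
  (Z + Z) + c * 1
    ≡⟨ cong (_+ c * 1) (sym (Σ-distrib-+ i _ _)) ⟩
  Σ≤ i (λ a → catalan a * ballot (i ∸ a) 1 + catalan a * ballot (i ∸ a) 1) + c * 1
    ≡⟨ cong (_+ c * 1) (Σ-cong i (λ a a≤i → trans (sym (*-distribˡ-+ (catalan a) _ _))
                                                  (cong (catalan a *_) (double-shifted a a≤i)))) ⟩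
  Σ≤ i (λ a → catalan a * ballot (suc i ∸ a) 0) + c * 1
    ≡⟨ cong (Σ≤ i (λ a → catalan a * ballot (suc i ∸ a) 0) +_)
            (cong (c *_) (cong (λ x → ballot x 0) (sym (n∸n≡0 i)))) ⟩
  Σ≤ i (λ a → catalan a * ballot (suc i ∸ a) 0) + c * ballot (suc i ∸ suc i) 0
    ≡⟨ sym (Σ-snoc i _) ⟩
  Σ≤ (suc i) (λ a → catalan a * ballot (suc i ∸ a) 0) ∎
  where
  c = catalan (suc i)
  Z = Σ≤ i (λ a → catalan a * ballot (i ∸ a) 1)
  rearrange : ∀ c z → c + z + z ≡ z + z + c * 1
  rearrange = solve-∀
  double-shifted : ∀ a → a ≤ i → ballot (i ∸ a) 1 + ballot (i ∸ a) 1 ≡ ballot (suc i ∸ a) 0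
  double-shifted a a≤i rewrite +-∸-assoc 1 a≤i = sym (ballot-double (i ∸ a))

-- WordSum z j F: the sum of F over all words with z letters false and j letters true.
WordSum : ℕ → ℕ → (List Bool → ℕ) → ℕ
WordSum zero    zero    F = F []
WordSum (suc z) zero    F = WordSum z zero (F ∘ (false ∷_))
WordSum zero    (suc j) F = WordSum zero j (F ∘ (true ∷_))
WordSum (suc z) (suc j) F = WordSum z (suc j) (F ∘ (false ∷_)) + WordSum (suc z) j (F ∘ (true ∷_))

WordSum-scale : ∀ z j c (F : List Bool → ℕ) → WordSum z j (λ w → c * F w) ≡ c * WordSum z j F
WordSum-scale zero    zero    c F = refl
WordSum-scale (suc z) zero    c F = WordSum-scale z zero c (F ∘ (false ∷_))
WordSum-scale zero    (suc j) c F = WordSum-scale zero j c (F ∘ (true ∷_))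
WordSum-scale (suc z) (suc j) c F =
  trans (cong₂ _+_ (WordSum-scale z (suc j) c _) (WordSum-scale (suc z) j c _)) (sym (*-distribˡ-+ c _ _))

-- The weight of a cyclic composition, computed by reading its word of deleted edges
-- (true = deleted) linearly.  'leadWeight p w' is the weight of the word false^p w:
-- it skips leading falses, which belong to the part that wraps around the cycle.
-- 'gapWeight g p w' continues after a deleted edge followed by g falses: every
-- further deleted edge closes a part of size g+1, contributing C_g, and at the end
-- the open part joins the p leading falses, contributing C_{g+p}.
gapWeight : ℕ → ℕ → List Bool → ℕ
gapWeight g p []          = catalan (g + p)
gapWeight g p (false ∷ w) = gapWeight (suc g) p w
gapWeight g p (true  ∷ w) = catalan g * gapWeight 0 p w

leadWeight : ℕ → List Bool → ℕ
leadWeight p []          = 1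
leadWeight p (false ∷ w) = leadWeight (suc p) w
leadWeight p (true  ∷ w) = gapWeight 0 p w

gapWeight-no-true : ∀ z g p → WordSum z 0 (gapWeight g p) ≡ catalan (z + g + p)
gapWeight-no-true zero    g p = refl
gapWeight-no-true (suc z) g p = trans (gapWeight-no-true z (suc g) p) (cong (λ x → catalan (x + p)) (+-suc z g))

gapWeight-first-part : ∀ z j g p →
  WordSum z (suc j) (gapWeight g p) ≡ Σ≤ z (λ t → catalan (g + t) * WordSum (z ∸ t) j (gapWeight 0 p))
gapWeight-first-part zero    j g p =
  trans (WordSum-scale zero j (catalan g) (gapWeight 0 p)) (cong (λ x → catalan x * WordSum 0 j (gapWeight 0 p)) (sym (+-identityʳ g)))
gapWeight-first-part (suc z) j g p = begin
  WordSum z (suc j) (gapWeight (suc g) p) + WordSum (suc z) j (λ w → catalan g * gapWeight 0 p w)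
    ≡⟨ cong₂ _+_ (gapWeight-first-part z j (suc g) p) (WordSum-scale (suc z) j (catalan g) (gapWeight 0 p)) ⟩
  Σ≤ z (λ t → catalan (suc g + t) * rest (z ∸ t)) + catalan g * rest (suc z)
    ≡⟨ +-comm (Σ≤ z (λ t → catalan (suc g + t) * rest (z ∸ t))) _ ⟩
  catalan g * rest (suc z) + Σ≤ z (λ t → catalan (suc g + t) * rest (z ∸ t))
    ≡⟨ cong₂ _+_ (cong (λ x → catalan x * rest (suc z)) (sym (+-identityʳ g)))
                 (Σ-cong z (λ t _ → cong (λ x → catalan x * rest (z ∸ t)) (sym (+-suc g t)))) ⟩
  catalan (g + 0) * rest (suc z) + Σ≤ z (λ t → catalan (g + suc t) * rest (z ∸ t)) ∎
  where
  rest : ℕ → ℕ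
  rest y = WordSum y j (gapWeight 0 p)

leadWeight-first-true : ∀ z j p →
  WordSum z (suc j) (leadWeight p) ≡ Σ≤ z (λ t → WordSum (z ∸ t) j (gapWeight 0 (p + t)))
leadWeight-first-true zero    j p = cong (λ x → WordSum zero j (gapWeight 0 x)) (sym (+-identityʳ p))
leadWeight-first-true (suc z) j p = begin
  WordSum z (suc j) (leadWeight (suc p)) + WordSum (suc z) j (gapWeight 0 p)
    ≡⟨ cong (_+ WordSum (suc z) j (gapWeight 0 p)) (leadWeight-first-true z j (suc p)) ⟩
  Σ≤ z (λ t → WordSum (z ∸ t) j (gapWeight 0 (suc p + t))) + WordSum (suc z) j (gapWeight 0 p)
    ≡⟨ +-comm (Σ≤ z (λ t → WordSum (z ∸ t) j (gapWeight 0 (suc p + t)))) _ ⟩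
  WordSum (suc z) j (gapWeight 0 p) + Σ≤ z (λ t → WordSum (z ∸ t) j (gapWeight 0 (suc p + t)))
    ≡⟨ cong₂ _+_ (cong (λ x → WordSum (suc z) j (gapWeight 0 x)) (sym (+-identityʳ p)))
                 (Σ-cong z (λ t _ → cong (λ x → WordSum (z ∸ t) j (gapWeight 0 x)) (sym (+-suc p t)))) ⟩
  WordSum (suc z) j (gapWeight 0 (p + 0)) + Σ≤ z (λ t → WordSum (z ∸ t) j (gapWeight 0 (p + suc t))) ∎

-- The total weight of the words with n falses and j+1 trues, organised by the
-- number t of leading falses.
RootedSum : ℕ → ℕ → ℕ
RootedSum n j = Σ≤ n (λ t → WordSum (n ∸ t) j (gapWeight 0 t))

-- A single deleted edge leaves one part, of n+1 vertices, whatever the number t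
-- of leading falses; the n+1 choices of t give (n+1) C_n.
RootedSum-one-part : ∀ n → RootedSum n 0 ≡ ballot n 0
RootedSum-one-part n = trans (Σ-const n _ (catalan n) part-size) (catalan-scaled n)
  where
  part-size : ∀ t → t ≤ n → WordSum (n ∸ t) 0 (gapWeight 0 t) ≡ catalan n
  part-size t t≤n = trans (gapWeight-no-true (n ∸ t) 0 t)
    (cong catalan (trans (cong (_+ t) (+-identityʳ (n ∸ t))) (m∸n+n≡m t≤n)))

-- Further parts: peel off the first part after the root, of r+1 vertices, and
-- exchange the two summations.
RootedSum-peel : ∀ n j → RootedSum n (suc j) ≡ Σ≤ n (λ r → catalan r * RootedSum (n ∸ r) j)
RootedSum-peel n j = begin
  Σ≤ n (λ t → WordSum (n ∸ t) (suc j) (gapWeight 0 t))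
    ≡⟨ Σ-cong n (λ t _ → gapWeight-first-part (n ∸ t) j 0 t) ⟩
  Triangle n G
    ≡⟨ Triangle-swap n G ⟩
  Σ≤ n (λ r → Σ≤ (n ∸ r) (λ t → catalan r * WordSum (n ∸ t ∸ r) j (gapWeight 0 t)))
    ≡⟨ Σ-cong n (λ r _ → trans (Σ-cong (n ∸ r) (λ t _ → cong (λ x → catalan r * WordSum x j (gapWeight 0 t))
                                                              (∸-swap n t r)))
                               (Σ-scale (n ∸ r) (catalan r) _)) ⟩
  Σ≤ n (λ r → catalan r * RootedSum (n ∸ r) j) ∎
  where
  G : ℕ → ℕ → ℕ
  G t r = catalan r * WordSum (n ∸ t ∸ r) j (gapWeight 0 t)
  ∸-swap : ∀ n t r → n ∸ t ∸ r ≡ n ∸ r ∸ t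
  ∸-swap n t r = trans (∸-+-assoc n t r) (trans (cong (n ∸_) (+-comm t r)) (sym (∸-+-assoc n r t)))

-- Both sides satisfy the same recursion in j (ballot-convolution).
RootedSum≡ballot : ∀ j n → RootedSum n j ≡ ballot n j
RootedSum≡ballot zero    n = RootedSum-one-part n
RootedSum≡ballot (suc j) n = begin
  RootedSum n (suc j)                         ≡⟨ RootedSum-peel n j ⟩
  Σ≤ n (λ r → catalan r * RootedSum (n ∸ r) j) ≡⟨ Σ-cong n (λ r _ → cong (catalan r *_) (RootedSum≡ballot j (n ∸ r))) ⟩
  Σ≤ n (λ r → catalan r * ballot (n ∸ r) j)    ≡⟨ sym (ballot-convolution n j) ⟩
  ballot n (suc j)                            ∎

filter-map : ∀ {A B : Set} {P : Pred B 0ℓ} (P? : Decidable P) (g : A → B) xs →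
  filter P? (map g xs) ≡ map g (filter (P? ∘ g) xs)
filter-map P? g []       = refl
filter-map P? g (x ∷ xs) with does (P? (g x))
... | true  = cong (g x ∷_) (filter-map P? g xs)
... | false = filter-map P? g xs

SubsetSum : ∀ m → ℕ → (Subset m → ℕ) → ℕ
SubsetSum m k F = sum (map F (filter (λ S → ∣ S ∣ ≟ k) (allSubsets m)))

SubsetSum-cong : ∀ m k {F G : Subset m → ℕ} → (∀ S → F S ≡ G S) → SubsetSum m k F ≡ SubsetSum m k G
SubsetSum-cong m k F≗G = cong sum (map-cong F≗G (filter (λ S → ∣ S ∣ ≟ k) (allSubsets m)))

SubsetSum-split : ∀ m k (F : Subset (suc m) → ℕ) →
  SubsetSum (suc m) k F ≡
  SubsetSum m k (F ∘ (outside ∷_)) + sum (map (F ∘ (inside ∷_)) (filter (λ S → ∣ inside ∷ S ∣ ≟ k) (allSubsets m)))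
SubsetSum-split m k F = begin
  sum (map F (filter sized (map (outside ∷_) subsets ++ map (inside ∷_) subsets)))
    ≡⟨ cong (sum ∘ map F) (filter-++ sized (map (outside ∷_) subsets) _) ⟩
  sum (map F (filter sized (map (outside ∷_) subsets) ++ filter sized (map (inside ∷_) subsets)))
    ≡⟨ cong sum (map-++ F (filter sized (map (outside ∷_) subsets)) _) ⟩
  sum (map F (filter sized (map (outside ∷_) subsets)) ++ map F (filter sized (map (inside ∷_) subsets)))
    ≡⟨ sum-++ (map F (filter sized (map (outside ∷_) subsets))) _ ⟩
  sum (map F (filter sized (map (outside ∷_) subsets))) + sum (map F (filter sized (map (inside ∷_) subsets)))
    ≡⟨ cong₂ _+_ (restrict (outside ∷_)) (restrict (inside ∷_)) ⟩
  SubsetSum m k (F ∘ (outside ∷_)) + sum (map (F ∘ (inside ∷_)) (filter (λ S → ∣ inside ∷ S ∣ ≟ k) subsets)) ∎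
  where
  subsets = allSubsets m
  sized : (S : Subset (suc m)) → Dec (∣ S ∣ ≡ k)
  sized S = ∣ S ∣ ≟ k
  restrict : (g : Subset m → Subset (suc m)) →
    sum (map F (filter sized (map g subsets))) ≡ sum (map (F ∘ g) (filter (sized ∘ g) subsets))
  restrict g = cong sum (trans (cong (map F) (filter-map sized g subsets)) (sym (map-∘ (filter (sized ∘ g) subsets))))

SubsetSum-zero : ∀ m (F : Subset (suc m) → ℕ) → SubsetSum (suc m) 0 F ≡ SubsetSum m 0 (F ∘ (outside ∷_))
SubsetSum-zero m F = trans (SubsetSum-split m 0 F)
  (trans (cong (λ l → SubsetSum m 0 (F ∘ (outside ∷_)) + sum (map (F ∘ (inside ∷_)) l))
               (filter-none (λ S → ∣ inside ∷ S ∣ ≟ 0) (universal (λ S ()) (allSubsets m))))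
         (+-identityʳ _))

SubsetSum-suc : ∀ m k (F : Subset (suc m) → ℕ) →
  SubsetSum (suc m) (suc k) F ≡ SubsetSum m (suc k) (F ∘ (outside ∷_)) + SubsetSum m k (F ∘ (inside ∷_))
SubsetSum-suc m k F = trans (SubsetSum-split m (suc k) F)
  (cong (λ l → SubsetSum m (suc k) (F ∘ (outside ∷_)) + sum (map (F ∘ (inside ∷_)) l))
        (filter-≐ (λ S → ∣ inside ∷ S ∣ ≟ suc k) (λ S → ∣ S ∣ ≟ k) (suc-injective , cong suc) (allSubsets m)))

SubsetSum-vanish : ∀ m k (F : Subset m → ℕ) → m < k → SubsetSum m k F ≡ 0
SubsetSum-vanish zero    (suc k) F _         = refl
SubsetSum-vanish (suc m) (suc k) F (s≤s m<k) = trans (SubsetSum-suc m k F)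
  (cong₂ _+_ (SubsetSum-vanish m (suc k) _ (m<n⇒m<1+n m<k)) (SubsetSum-vanish m k _ m<k))

SubsetSum-resize : ∀ {m m′} → m ≡ m′ → ∀ k (G : List Bool → ℕ) →
  SubsetSum m k (G ∘ toList) ≡ SubsetSum m′ k (G ∘ toList)
SubsetSum-resize refl k G = refl

SubsetSum≡WordSum : ∀ z j (G : List Bool → ℕ) → SubsetSum (z + j) j (G ∘ toList) ≡ WordSum z j G
SubsetSum≡WordSum zero    zero    G = +-identityʳ (G [])
SubsetSum≡WordSum (suc z) zero    G = trans (SubsetSum-zero (z + 0) (G ∘ toList)) (SubsetSum≡WordSum z zero (G ∘ (false ∷_)))
SubsetSum≡WordSum zero    (suc j) G = begin
  SubsetSum (suc j) (suc j) (G ∘ toList)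
    ≡⟨ SubsetSum-suc j j (G ∘ toList) ⟩
  SubsetSum j (suc j) _ + SubsetSum j j ((G ∘ (true ∷_)) ∘ toList)
    ≡⟨ cong (_+ SubsetSum j j ((G ∘ (true ∷_)) ∘ toList)) (SubsetSum-vanish j (suc j) _ (n<1+n j)) ⟩
  SubsetSum j j ((G ∘ (true ∷_)) ∘ toList)
    ≡⟨ SubsetSum≡WordSum zero j (G ∘ (true ∷_)) ⟩
  WordSum zero j (G ∘ (true ∷_)) ∎
SubsetSum≡WordSum (suc z) (suc j) G = trans (SubsetSum-suc (z + suc j) j (G ∘ toList))
  (cong₂ _+_ (SubsetSum≡WordSum z (suc j) (G ∘ (false ∷_)))
             (trans (SubsetSum-resize (+-suc z j) j (G ∘ (true ∷_))) (SubsetSum≡WordSum (suc z) j (G ∘ (true ∷_)))))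

markedProduct : (ℕ → Bool) → (ℕ → ℕ) → ℕ → ℕ → ℕ
markedProduct b F q zero    = 1
markedProduct b F q (suc m) = (if b q then F q else 1) * markedProduct b F (suc q) m

product-filter-tabulate : ∀ {A : Set} m (g : Fin m → A) (h : A → Bool) (f : A → ℕ) (b : ℕ → Bool) (F : ℕ → ℕ) q →
  (∀ e → h (g e) ≡ b (toℕ e + q)) → (∀ e → f (g e) ≡ F (toℕ e + q)) →
  product (map f (filter (T? ∘ h) (tabulate g))) ≡ markedProduct b F q m
product-filter-tabulate zero    g h f b F q h≗b f≗F = refl
product-filter-tabulate (suc m) g h f b F q h≗b f≗F
  with h (g fzero) | b q | h≗b fzero | product-filter-tabulate m (g ∘ fsuc) h f b F (suc q)
         (λ e → trans (h≗b (fsuc e)) (cong b (sym (+-suc (toℕ e) q))))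
         (λ e → trans (f≗F (fsuc e)) (cong F (sym (+-suc (toℕ e) q))))
... | true  | _ | refl | rest = cong₂ _*_ (f≗F fzero) rest
... | false | _ | refl | rest = trans rest (sym (+-identityʳ _))

window : (ℕ → Bool) → ℕ → ℕ → List Bool
window b q zero    = []
window b q (suc m) = b q ∷ window b (suc q) m

toList-window : ∀ {m} (R : Vec Bool m) (b : ℕ → Bool) q → (∀ e → lookup R e ≡ b (toℕ e + q)) → toList R ≡ window b q m
toList-window []      b q R≗b = refl
toList-window (x ∷ R) b q R≗b =
  cong₂ _∷_ (R≗b fzero) (toList-window R b (suc q) (λ e → trans (R≗b (fsuc e)) (cong b (sym (+-suc (toℕ e) q)))))

AllFalseBelow : (ℕ → Bool) → ℕ → Set
AllFalseBelow f g = ∀ t → t < g → f t ≡ false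

AllFalseBelow-extend : ∀ f g → AllFalseBelow f g → f g ≡ false → AllFalseBelow f (suc g)
AllFalseBelow-extend f g below fg t t<sg with m<1+n⇒m<n∨m≡n t<sg
... | inj₁ t<g  = below t t<g
... | inj₂ refl = fg

firstWhere : ℕ → (ℕ → Bool) → List ℕ → ℕ
firstWhere o h []       = o
firstWhere o h (t ∷ ts) = if h t then t else firstWhere o h ts

firstWhere-applyUpTo : ∀ o (h : ℕ → Bool) N (f : ℕ → ℕ) m → m < N →
  AllFalseBelow (h ∘ f) m → h (f m) ≡ true → firstWhere o h (applyUpTo f N) ≡ f m
firstWhere-applyUpTo o h (suc N) f zero    _         _    hit rewrite hit = refl
firstWhere-applyUpTo o h (suc N) f (suc m) (s≤s m<N) miss hit rewrite miss 0 z<s =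
  firstWhere-applyUpTo o h N (f ∘ suc) m m<N (λ t t<m → miss (suc t) (s≤s t<m)) hit

module CyclicComposition (n : ℕ) (S : Subset (suc n)) where

  deleted : ℕ → Bool
  deleted x = lookup S (fromℕ< (m%n<n x (suc n)))

  partFrom : ℕ → ℕ
  partFrom i = firstWhere (suc n) (λ t → deleted (i + t)) (applyUpTo suc (suc n))

  partWeight : ℕ → ℕ
  partWeight i = catalan (partFrom i ∸ 1)

  deleted-lookup : ∀ e → lookup S e ≡ deleted (toℕ e + 0)
  deleted-lookup e = begin
    lookup S e                               ≡⟨ cong (lookup S) (sym (fromℕ<-toℕ e (toℕ<n e))) ⟩
    lookup S (fromℕ< (toℕ<n e))              ≡⟨ cong (lookup S) (fromℕ<-cong _ _ (sym (m<n⇒m%n≡m (toℕ<n e))) _ _) ⟩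
    deleted (toℕ e)                          ≡⟨ cong deleted (sym (+-identityʳ (toℕ e))) ⟩
    deleted (toℕ e + 0)                      ∎

  deleted-periodic : ∀ x → deleted (suc n + x) ≡ deleted x
  deleted-periodic x = cong (lookup S)
    (fromℕ<-cong _ _ (trans (cong (_% suc n) (+-comm (suc n) x)) ([m+n]%n≡m%n x (suc n))) _ _)

  partSize≡partFrom : ∀ e → partSize S e ≡ partFrom (toℕ e)
  partSize≡partFrom e = scan (applyUpTo suc (suc n))
    where
    scan : ∀ ts → firstHit S e ts ≡ firstWhere (suc n) (λ t → deleted (toℕ e + t)) ts
    scan []       = refl
    scan (t ∷ ts) = cong (if deleted (toℕ e + t) then t else_) (scan ts)

  partFrom-next : ∀ i g → g < suc n → AllFalseBelow (λ t → deleted (i + suc t)) g →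
    deleted (i + suc g) ≡ true → partFrom i ≡ suc g
  partFrom-next i g g<d = firstWhere-applyUpTo (suc n) (λ t → deleted (i + t)) (suc n) suc g g<d

  weight≡markedProduct : weight S ≡ markedProduct deleted partWeight 0 (suc n)
  weight≡markedProduct = product-filter-tabulate (suc n) (λ e → e) (lookup S)
    (λ e → catalan (partSize S e ∸ 1)) deleted partWeight 0 deleted-lookup
    (λ e → cong (λ s → catalan (s ∸ 1)) (trans (partSize≡partFrom e) (cong partFrom (sym (+-identityʳ (toℕ e))))))

  -- Invariants of the linear scan: edges l+1,…,l+g are kept; edges 0,…,p−1 are kept.
  GapAfter : ℕ → ℕ → Set
  GapAfter l g = AllFalseBelow (λ t → deleted (l + suc t)) g

  NoneBefore : ℕ → Set
  NoneBefore p = AllFalseBelow deleted p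

  -- The last part wraps around: after the last deleted edge l come the g kept edges
  -- up to the end and then the p kept edges before the first deleted edge p.
  wrap-around : ∀ l g p → l + suc g ≡ suc n → GapAfter l g → p ≤ l → NoneBefore p →
    deleted p ≡ true → partFrom l ≡ suc (g + p)
  wrap-around l g p end gap p≤l none first = partFrom-next l (g + p) bound miss hit
    where
    shift : ∀ x → l + suc (g + x) ≡ suc n + x
    shift x = trans (sym (+-assoc l (suc g) x)) (cong (_+ x) end)
    bound : g + p < suc n
    bound = subst (g + p <_) (trans (+-comm (suc g) l) end) (s≤s (+-monoʳ-≤ g p≤l))
    miss : GapAfter l (g + p)
    miss t t<g+p with t <? g
    ... | yes t<g = gap t t<g
    ... | no  t≮g = begin
      deleted (l + suc t)        ≡⟨ cong (λ y → deleted (l + suc y)) (sym (m+[n∸m]≡n g≤t)) ⟩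
      deleted (l + suc (g + x))  ≡⟨ cong deleted (shift x) ⟩
      deleted (suc n + x)        ≡⟨ deleted-periodic x ⟩
      deleted x                  ≡⟨ none x (+-cancelˡ-< g x p (subst (_< g + p) (sym (m+[n∸m]≡n g≤t)) t<g+p)) ⟩
      false                      ∎
      where
      g≤t = ≮⇒≥ t≮g
      x = t ∸ g
    hit : deleted (l + suc (g + p)) ≡ true
    hit = trans (cong deleted (shift p)) (trans (deleted-periodic p) first)

  -- Scanning the edges q, q+1, …, n after the last deleted edge l (with q = l+g+1)
  -- reproduces gapWeight: the part started by l is closed either by the next
  -- deleted edge or, at the end, by wrapping around to the first deleted edge p.
  scan-gap : ∀ m q l g p → q + m ≡ suc n → q ≡ l + suc g → GapAfter l g → p ≤ l → NoneBefore p →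
    deleted p ≡ true → partWeight l * markedProduct deleted partWeight q m ≡ gapWeight g p (window deleted q m)
  scan-gap zero    q l g p end q≡ gap p≤l none first = begin
    partWeight l * 1           ≡⟨ *-identityʳ (partWeight l) ⟩
    catalan (partFrom l ∸ 1)   ≡⟨ cong (λ s → catalan (s ∸ 1)) (wrap-around l g p last gap p≤l none first) ⟩
    catalan (g + p)            ∎
    where
    last : l + suc g ≡ suc n
    last = trans (sym q≡) (trans (sym (+-identityʳ q)) end)
  scan-gap (suc m) q l g p end q≡ gap p≤l none first with deleted q in deleted-q
  ... | false = trans (cong (partWeight l *_) (*-identityˡ _))
    (scan-gap m (suc q) l (suc g) p end′ (trans (cong suc q≡) (sym (+-suc l (suc g))))
      (AllFalseBelow-extend _ g gap (trans (cong deleted (sym q≡)) deleted-q)) p≤l none first)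
    where end′ = trans (sym (+-suc q m)) end
  ... | true  = cong₂ _*_ closed
    (scan-gap m (suc q) q 0 p end′ (sym (+-comm q 1)) (λ t ()) (≤-trans p≤l l≤q) none first)
    where
    end′ = trans (sym (+-suc q m)) end
    l≤q : l ≤ q
    l≤q = subst (l ≤_) (sym q≡) (m≤m+n l (suc g))
    q<d : q < suc n
    q<d = subst (q <_) end (m<m+n q z<s)
    g<d : g < suc n
    g<d = <-trans (<-≤-trans (n<1+n g) (≤-trans (m≤n+m (suc g) l) (≤-reflexive (sym q≡)))) q<d
    closed : partWeight l ≡ catalan g
    closed = cong (λ s → catalan (s ∸ 1)) (partFrom-next l g g<d gap (trans (cong deleted (sym q≡)) deleted-q))

  scan-lead : ∀ m q → q + m ≡ suc n → NoneBefore q →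
    markedProduct deleted partWeight q m ≡ leadWeight q (window deleted q m)
  scan-lead zero    q end none = refl
  scan-lead (suc m) q end none with deleted q in deleted-q
  ... | false = trans (*-identityˡ _)
    (scan-lead m (suc q) (trans (sym (+-suc q m)) end) (AllFalseBelow-extend deleted q none deleted-q))
  ... | true  = scan-gap m (suc q) q 0 q (trans (sym (+-suc q m)) end) (sym (+-comm q 1)) (λ t ()) ≤-refl none deleted-q

  weight≡leadWeight : weight S ≡ leadWeight 0 (toList S)
  weight≡leadWeight = begin
    weight S                                         ≡⟨ weight≡markedProduct ⟩
    markedProduct deleted partWeight 0 (suc n)       ≡⟨ scan-lead (suc n) 0 refl (λ t ()) ⟩
    leadWeight 0 (window deleted 0 (suc n))          ≡⟨ cong (leadWeight 0) (sym (toList-window S deleted 0 deleted-lookup)) ⟩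
    leadWeight 0 (toList S)                          ∎

top-index : ∀ z j → 2 * suc (z + j) ∸ suc j ∸ 1 ≡ z + (z + j)
top-index z j = begin
  2 * suc (z + j) ∸ suc j ∸ 1                ≡⟨ ∸-+-assoc (2 * suc (z + j)) (suc j) 1 ⟩
  2 * suc (z + j) ∸ (suc j + 1)              ≡⟨ cong (_∸ (suc j + 1)) (expand z j) ⟩
  z + (z + j) + (suc j + 1) ∸ (suc j + 1)    ≡⟨ m+n∸n≡m (z + (z + j)) (suc j + 1) ⟩
  z + (z + j)                                ∎
  where
  expand : ∀ z j → 2 * suc (z + j) ≡ z + (z + j) + (suc j + 1)
  expand = solve-∀

lemma3p4 : (d k : ℕ) → 1 ≤ k → k ≤ d →
    cycSum d k ≡ (2 * d ∸ k ∸ 1) C (d ∸ 1)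
lemma3p4 zero    (suc k) _ ()
lemma3p4 (suc n) (suc j) _ (s≤s j≤n) =
  subst (λ m → cycSum (suc m) (suc j) ≡ (2 * suc m ∸ suc j ∸ 1) C m) (m∸n+n≡m j≤n) (kept-deleted (n ∸ j))
  where
  -- the cycle has z kept edges and j+1 deleted ones
  kept-deleted : ∀ z → cycSum (suc (z + j)) (suc j) ≡ (2 * suc (z + j) ∸ suc j ∸ 1) C (z + j)
  kept-deleted z = begin
    SubsetSum (suc (z + j)) (suc j) weight
      ≡⟨ SubsetSum-cong (suc (z + j)) (suc j) (CyclicComposition.weight≡leadWeight (z + j)) ⟩
    SubsetSum (suc (z + j)) (suc j) (leadWeight 0 ∘ toList)
      ≡⟨ SubsetSum-resize (sym (+-suc z j)) (suc j) (leadWeight 0) ⟩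
    SubsetSum (z + suc j) (suc j) (leadWeight 0 ∘ toList)
      ≡⟨ SubsetSum≡WordSum z (suc j) (leadWeight 0) ⟩
    WordSum z (suc j) (leadWeight 0)
      ≡⟨ leadWeight-first-true z j 0 ⟩
    RootedSum z j
      ≡⟨ RootedSum≡ballot j z ⟩
    ballot z j
      ≡⟨ ballot-symmetric z j ⟩
    (z + (z + j)) C (z + j)
      ≡⟨ cong (_C (z + j)) (sym (top-index z j)) ⟩
    (2 * suc (z + j) ∸ suc j ∸ 1) C (z + j) ∎
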